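{- Let $1\le t\le n$ and let $\mathcal{C}\subseteq\mathbb{S}_n$ be a $t$-balanced code. Then $\mathrm{d}_\mathrm{K}(\mathcal{C})=\binom{t}{2}+1$. In particular, $\mathcal{C}$ is an MDS code.
   Context: $\mathbb{S}_n$ is the group of permutations of $[n]=\{1,\dots,n\}$, written in one-line notation. The Kendall-$\tau$ distance $\mathrm{d}_\mathrm{K}(\sigma,\tau)$ is the minimum number of adjacent transpositions (swaps of two consecutive entries in one-line notation) needed to obtain $\sigma$ from $\tau$. A code is a subset $\mathcal{C}\subseteq\mathbb{S}_n$ with $|\mathcal{C}|\ge 2$; its minimum distance is $\mathrm{d}_\mathrm{K}(\mathcal{C})=\min\{\mathrm{d}_\mathrm{K}(\sigma,\tau):\sigma\neq\tau\in\mathcal{C}\}$. A code $\mathcal{C}\subseteq\mathbb{S}_n$ is $t$-balanced if $\mathrm{d}_\mathrm{K}(\mathcal{C})>\binom{t}{2}$ and $|\mathcal{C}|=n!/t!$. A code $\mathcal{C}\subseteq \mathbb{S}_n$ with $|\mathcal{C}|=n!/t!$ (for an integer $1\le t\le n-2$) is called MDS if its minimum distance meets with equality the (known) upper bound $\mathrm{d}_\mathrm{K}(\mathcal{C})\le\binom{t}{2}+1$, i.e. $\mathrm{d}_\mathrm{K}(\mathcal{C})=\binom{t}{2}+1$. -}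

module Defs where

open import Data.Nat using (ℕ; zero; suc; _+_; _≤_; _<_; _!; _/_)
open import Data.Nat.Properties using (_!≢0)
open import Data.Fin using (Fin)
open import Data.Vec using (Vec; []; _∷_; toList)
open import Data.List using (List; length)
open import Data.List.Membership.Propositional using (_∈_)
open import Data.List.Relation.Unary.All using (All)
import Data.List.Relation.Unary.Unique.Propositional as UniqueP
open import Data.Product using (Σ; _×_; ∃)
open import Relation.Binary.PropositionalEquality using (_≡_; _≢_)
open import Data.Nat.Combinatorics using (_C_)

-- A permutation of [n] = {0,…,n-1} in one-line notation:
-- a word of length n over Fin n with pairwise distinct entries.
Word : ℕ → Set
Word n = Vec (Fin n) n

IsPerm : ∀ {n} → Word n → Set
IsPerm w = UniqueP.Unique (toList w)

data AdjSwap {A : Set} : ∀ {m} → Vec A m → Vec A m → Set where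
  here  : ∀ {m} x y (xs : Vec A m) → AdjSwap (x ∷ y ∷ xs) (y ∷ x ∷ xs)
  there : ∀ {m} x {xs ys : Vec A m} → AdjSwap xs ys → AdjSwap (x ∷ xs) (x ∷ ys)

data Steps {A : Set} {m : ℕ} : ℕ → Vec A m → Vec A m → Set where
  done : ∀ {σ} → Steps zero σ σ
  step : ∀ {k σ ρ τ} → AdjSwap σ ρ → Steps k ρ τ → Steps (suc k) σ τ

DistK : ∀ {n} → Word n → Word n → ℕ → Set
DistK σ τ d = Steps d σ τ × (∀ k → Steps k σ τ → d ≤ k)

IsCode : ∀ {n} → List (Word n) → Set
IsCode {n} 𝒞 = All IsPerm 𝒞 × UniqueP.Unique 𝒞 × (2 ≤ length 𝒞)

MinDistGT : ∀ {n} → List (Word n) → ℕ → Set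
MinDistGT 𝒞 m = ∀ {σ τ} → σ ∈ 𝒞 → τ ∈ 𝒞 → σ ≢ τ → ∀ k → Steps k σ τ → m < k

MinDist : ∀ {n} → List (Word n) → ℕ → Set
MinDist 𝒞 d =
  (∃ λ σ → ∃ λ τ → σ ∈ 𝒞 × τ ∈ 𝒞 × σ ≢ τ × DistK σ τ d)
  × (∀ {σ τ} → σ ∈ 𝒞 → τ ∈ 𝒞 → σ ≢ τ → ∀ k → Steps k σ τ → d ≤ k)

TBalanced : (n t : ℕ) → List (Word n) → Set
TBalanced n t 𝒞 = MinDistGT 𝒞 (t C 2) × length 𝒞 ≡ _/_ (n !) (t !) {{t !≢0}}

{-# OPTIONS --safe #-}
-- Let m = n ∸ t. Two permutations with the same first m entries differ by a rearrangement of
-- their last t entries, which bubble sort undoes with at most C(t,2) adjacent transpositions.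
-- Hence distinct codewords have distinct length-m prefixes, and since there are only
-- n!/t! = |𝒞| injective words of length m over [n], every such word is the prefix of a
-- codeword. Swapping the entries at positions m and m+1 of a codeword σ changes its prefix, so
-- the result shares its prefix with another codeword τ, which is then within 1 + C(t,2)
-- transpositions of σ. (If t = n the code would have n!/n! = 1 element.)
module Submission where

open import Data.Fin using (Fin)
open import Data.Fin.Properties using (_≟_)
open import Data.List using (List; []; _∷_; _++_; length; map; take; concatMap; allFin)
open import Data.List.Membership.Propositional using (_∈_; lose)
open import Data.List.Membership.Propositional.Properties
  using (∈-∃++; ∈-map⁺; ∈-map⁻; ∈-concatMap⁺; ∈-allFin)
import Data.List.Membership.DecPropositional as DecMembership
open import Data.List.Properties
  using ( length-++; length-++-sucʳ; length-map; length-tabulate; length-take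
        ; ∷-injective; ∷-injectiveʳ; ≡-dec)
open import Data.List.Relation.Binary.Subset.Propositional using (_⊆_)
open import Data.List.Relation.Binary.Subset.Propositional.Properties
  using (xs⊆x∷xs; ∷⁺ʳ; ∈-∷⁺ʳ; ⊆∷∧∉⇒⊆; ⊆-respʳ-↭)
open import Data.List.Relation.Binary.Permutation.Propositional.Properties using (shift)
open import Data.List.Relation.Unary.All as All using (All; []; _∷_)
open import Data.List.Relation.Unary.All.Properties
  using (¬Any⇒All¬; All¬⇒¬Any) renaming (map⁺ to All-map⁺)
open import Data.List.Relation.Unary.Any as Any using (here; there)
open import Data.List.Relation.Unary.Unique.Propositional using (Unique; []; _∷_)
open import Data.List.Relation.Unary.Unique.Propositional.Properties using (take⁺)
open import Data.Nat using (ℕ; zero; suc; pred; _+_; _*_; _∸_; _⊓_; _≤_; _<_; z≤n; s≤s; _!; _/_)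
open import Data.Nat.Combinatorics using (_C_; nC1≡n; nCk+nC[k+1]≡[n+1]C[k+1])
open import Data.Nat.Combinatorics.Base using (_P′_)
open import Data.Nat.Combinatorics.Specification using (nP′k≡n!/[n∸k]!; nP′k≡n[n∸1P′k∸1])
open import Data.Nat.DivMod using (n/n≡1; /-congʳ)
open import Data.Nat.Properties
  using ( module ≤-Reasoning; ≤-reflexive; ≤-antisym; <⇒≱; <⇒≢; m≤n⇒m<n∨m≡n; +-comm; +-mono-≤
        ; 0∸n≡0; m∸n≤m; m∸[m∸n]≡n; m<n⇒0<n∸m; ∸-monoʳ-<; m≤n⇒m⊓n≡m; _!≢0)
open import Data.Product using (∃; _×_; _,_; proj₁; map₂)
open import Data.Sum using (inj₁; inj₂)
open import Data.Vec using (Vec; []; _∷_; toList)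
open import Data.Vec.Properties using (length-toList)
open import Function using (_∘_; id)
open import Relation.Binary.Definitions using (DecidableEquality)
open import Relation.Binary.PropositionalEquality
  using (_≡_; _≢_; refl; sym; trans; cong; cong₂; subst; ≢-sym; module ≡-Reasoning)
open import Relation.Nullary using (contradiction)
open import Relation.Nullary.Decidable using (decidable-stable)

open import Defs

module _ {A : Set} where

  x∷xs⊆y∷x∷ys : ∀ {x y : A} {xs ys} → xs ⊆ y ∷ ys → x ∷ xs ⊆ y ∷ x ∷ ys
  x∷xs⊆y∷x∷ys {x} {y} {ys = ys} xs⊆y∷ys =
    ∈-∷⁺ʳ (there (here refl)) (∷⁺ʳ y (xs⊆x∷xs ys x) ∘ xs⊆y∷ys)

  Unique⇒length≤ : {xs ys : List A} → Unique xs → xs ⊆ ys → length xs ≤ length ys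
  Unique⇒length≤ {[]} _ _ = z≤n
  Unique⇒length≤ {x ∷ xs} (x∉xs ∷ !xs) x∷xs⊆ys with ∈-∃++ (x∷xs⊆ys (here refl))
  ... | as , bs , refl = begin
    suc (length xs)         ≤⟨ s≤s (Unique⇒length≤ !xs xs⊆as++bs) ⟩
    suc (length (as ++ bs)) ≡⟨ length-++-sucʳ as x bs ⟨
    length (as ++ x ∷ bs)   ∎
    where
    open ≤-Reasoning
    xs⊆as++bs : xs ⊆ as ++ bs
    xs⊆as++bs = ⊆∷∧∉⇒⊆ (⊆-respʳ-↭ (shift x as bs) x∷xs⊆ys ∘ there) (All¬⇒¬Any x∉xs)

  Unique-⊆-length≥⇒⊇ : DecidableEquality A → {xs ys : List A} →
                       Unique xs → xs ⊆ ys → length ys ≤ length xs → ys ⊆ xs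
  Unique-⊆-length≥⇒⊇ _≟ₐ_ {xs} !xs xs⊆ys |ys|≤|xs| {y} y∈ys =
    decidable-stable (y ∈? xs) λ y∉xs →
      <⇒≱ (Unique⇒length≤ (¬Any⇒All¬ xs y∉xs ∷ !xs) (∈-∷⁺ʳ y∈ys xs⊆ys)) |ys|≤|xs|
    where open DecMembership _≟ₐ_ using (_∈?_)

  Unique-map⁺-on : {B : Set} (f : A → B) {xs : List A} →
                   (∀ {x y} → x ∈ xs → y ∈ xs → x ≢ y → f x ≢ f y) →
                   Unique xs → Unique (map f xs)
  Unique-map⁺-on f {[]} _ [] = []
  Unique-map⁺-on f {x ∷ xs} f-inj (x∉xs ∷ !xs) =
    All-map⁺ (All.tabulate λ y∈xs → f-inj (here refl) (there y∈xs) (All.lookup x∉xs y∈xs))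
    ∷ Unique-map⁺-on f (λ x∈ y∈ → f-inj (there x∈) (there y∈)) !xs

length-concatMap-const : {B C : Set} (f : B → List C) {c : ℕ} (xs : List B) →
                         All (λ x → length (f x) ≡ c) xs → length (concatMap f xs) ≡ length xs * c
length-concatMap-const f [] [] = refl
length-concatMap-const f (x ∷ xs) (|fx|≡c ∷ rest) =
  trans (length-++ (f x)) (cong₂ _+_ |fx|≡c (length-concatMap-const f xs rest))

n*[n-1P′m]≡nP′[1+m] : ∀ n m → n * (pred n P′ m) ≡ n P′ suc m
n*[n-1P′m]≡nP′[1+m] zero m = sym (cong (_* (0 P′ m)) (0∸n≡0 m))
n*[n-1P′m]≡nP′[1+m] (suc n) m = sym (nP′k≡n[n∸1P′k∸1] (suc n) (suc m))

module _ {A : Set} where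

  selections : List A → List (A × List A)
  selections [] = []
  selections (x ∷ xs) = (x , xs) ∷ map (map₂ (x ∷_)) (selections xs)

  length-selections : (R : List A) → length (selections R) ≡ length R
  length-selections [] = refl
  length-selections (x ∷ xs) =
    cong suc (trans (length-map _ (selections xs)) (length-selections xs))

  selections-rest : (R : List A) → All (λ (_ , R′) → suc (length R′) ≡ length R) (selections R)
  selections-rest [] = []
  selections-rest (x ∷ xs) = refl ∷ All-map⁺ (All.map (cong suc) (selections-rest xs))

  ∈-selections : ∀ {x : A} {R} → x ∈ R → ∃ λ R′ → (x , R′) ∈ selections R × R ⊆ x ∷ R′
  ∈-selections {R = x ∷ xs} (here refl) = xs , here refl , id
  ∈-selections {x} {R = y ∷ ys} (there x∈ys) with ∈-selections x∈ys
  ... | R′ , sel , ys⊆x∷R′ = y ∷ R′ , there (∈-map⁺ (map₂ (y ∷_)) sel) , x∷xs⊆y∷x∷ys ys⊆x∷R′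

  injectiveWords : List A → ℕ → List (List A)
  injectiveWords R zero = [] ∷ []
  injectiveWords R (suc m) =
    concatMap (λ (x , R′) → map (x ∷_) (injectiveWords R′ m)) (selections R)

  ∈-injectiveWords : ∀ {R w : List A} → Unique w → w ⊆ R → w ∈ injectiveWords R (length w)
  ∈-injectiveWords {w = []} _ _ = here refl
  ∈-injectiveWords {R} {x ∷ w} (x∉w ∷ !w) x∷w⊆R with ∈-selections (x∷w⊆R (here refl))
  ... | R′ , sel , R⊆x∷R′ = ∈-concatMap⁺ _ (lose sel (∈-map⁺ (x ∷_) (∈-injectiveWords !w w⊆R′)))
    where
    w⊆R′ : w ⊆ R′
    w⊆R′ = ⊆∷∧∉⇒⊆ (R⊆x∷R′ ∘ x∷w⊆R ∘ there) (All¬⇒¬Any x∉w)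

  length-injectiveWords : ∀ (R : List A) m → length (injectiveWords R m) ≡ length R P′ m
  length-injectiveWords R zero = refl
  length-injectiveWords R (suc m) = begin
    length (injectiveWords R (suc m))
      ≡⟨ length-concatMap-const _ (selections R) (All.map extensionLength (selections-rest R)) ⟩
    length (selections R) * (pred (length R) P′ m)
      ≡⟨ cong (_* (pred (length R) P′ m)) (length-selections R) ⟩
    length R * (pred (length R) P′ m)
      ≡⟨ n*[n-1P′m]≡nP′[1+m] (length R) m ⟩
    length R P′ suc m
      ∎
    where
    open ≡-Reasoning
    extensionLength : ∀ {x R′} → suc (length R′) ≡ length R →
                      length (map (x ∷_) (injectiveWords R′ m)) ≡ pred (length R) P′ m
    extensionLength {x} {R′} |R′|+1≡|R| = begin
      length (map (x ∷_) (injectiveWords R′ m)) ≡⟨ length-map (x ∷_) (injectiveWords R′ m) ⟩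
      length (injectiveWords R′ m)              ≡⟨ length-injectiveWords R′ m ⟩
      length R′ P′ m                            ≡⟨ cong (λ k → pred k P′ m) |R′|+1≡|R| ⟩
      pred (length R) P′ m                      ∎

module _ {A : Set} where

  StepsWithin : ∀ {l} → ℕ → Vec A l → Vec A l → Set
  StepsWithin d σ τ = ∃ λ k → k ≤ d × Steps k σ τ

  Steps-trans : ∀ {l i j} {σ ρ τ : Vec A l} → Steps i σ ρ → Steps j ρ τ → Steps (i + j) σ τ
  Steps-trans done ρ→τ = ρ→τ
  Steps-trans (step s σ→ρ) ρ→τ = step s (Steps-trans σ→ρ ρ→τ)

  Steps-snoc : ∀ {l k} {σ ρ τ : Vec A l} → Steps k σ ρ → AdjSwap ρ τ → Steps (suc k) σ τ
  Steps-snoc done s = step s done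
  Steps-snoc (step s′ σ→ρ) s = step s′ (Steps-snoc σ→ρ s)

  Steps-∷ : ∀ {l k} x {σ τ : Vec A l} → Steps k σ τ → Steps k (x ∷ σ) (x ∷ τ)
  Steps-∷ x done = done
  Steps-∷ x (step s σ→τ) = step (there x s) (Steps-∷ x σ→τ)

  AdjSwap-Unique : ∀ {l} {σ τ : Vec A l} → AdjSwap σ τ → Unique (toList σ) → Unique (toList τ)
  AdjSwap-Unique (here x y σ) ((x≢y ∷ x∉σ) ∷ y∉σ ∷ !σ) = (≢-sym x≢y ∷ y∉σ) ∷ x∉σ ∷ !σ
  AdjSwap-Unique (there x s) (x∉σ ∷ !σ) = AdjSwap-All s x∉σ ∷ AdjSwap-Unique s !σ
    where
    AdjSwap-All : ∀ {P : A → Set} {l} {σ τ : Vec A l} →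
                  AdjSwap σ τ → All P (toList σ) → All P (toList τ)
    AdjSwap-All (here x y σ) (px ∷ py ∷ pσ) = py ∷ px ∷ pσ
    AdjSwap-All (there x s) (px ∷ pσ) = px ∷ AdjSwap-All s pσ

  moveToFront : ∀ {l} {y : A} (σ : Vec A (suc l)) → y ∈ toList σ →
                ∃ λ ρ → StepsWithin l σ (y ∷ ρ) × toList σ ⊆ y ∷ toList ρ
  moveToFront (y ∷ σ) (here refl) = σ , (0 , z≤n , done) , id
  moveToFront {zero} (x ∷ []) (there ())
  moveToFront {suc l} {y} (x ∷ σ) (there y∈σ) with moveToFront σ y∈σ
  ... | ρ , (i , i≤l , σ→y∷ρ) , σ⊆y∷ρ =
    x ∷ ρ , (suc i , s≤s i≤l , Steps-snoc (Steps-∷ x σ→y∷ρ) (here x y ρ)) , x∷xs⊆y∷x∷ys σ⊆y∷ρ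

  [1+l]C2≡l+lC2 : ∀ l → suc l C 2 ≡ l + l C 2
  [1+l]C2≡l+lC2 l = trans (sym (nCk+nC[k+1]≡[n+1]C[k+1] l 1)) (cong (_+ l C 2) (nC1≡n l))

  sortWithin : ∀ {l} (σ τ : Vec A l) → Unique (toList τ) → toList τ ⊆ toList σ →
               StepsWithin (l C 2) σ τ
  sortWithin [] [] _ _ = 0 , z≤n , done
  sortWithin {suc l} σ (y ∷ τ) (y∉τ ∷ !τ) y∷τ⊆σ with moveToFront σ (y∷τ⊆σ (here refl))
  ... | ρ , (i , i≤l , σ→y∷ρ) , σ⊆y∷ρ
    with sortWithin ρ τ !τ (⊆∷∧∉⇒⊆ (σ⊆y∷ρ ∘ y∷τ⊆σ ∘ there) (All¬⇒¬Any y∉τ))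
  ... | k , k≤lC2 , ρ→τ =
    i + k , subst (i + k ≤_) (sym ([1+l]C2≡l+lC2 l)) (+-mono-≤ i≤l k≤lC2) ,
    Steps-trans σ→y∷ρ (Steps-∷ y ρ→τ)

  samePrefixWithin : ∀ {l} m (σ τ : Vec A l) → take m (toList σ) ≡ take m (toList τ) →
                     Unique (toList τ) → toList τ ⊆ toList σ → StepsWithin ((l ∸ m) C 2) σ τ
  samePrefixWithin zero σ τ _ = sortWithin σ τ
  samePrefixWithin (suc m) [] [] _ _ _ = 0 , z≤n , done
  samePrefixWithin (suc m) (x ∷ σ) (y ∷ τ) x∷σ≡y∷τ (y∉τ ∷ !τ) y∷τ⊆x∷σ with ∷-injective x∷σ≡y∷τ
  ... | refl , σ≡τ
    with samePrefixWithin m σ τ σ≡τ !τ (⊆∷∧∉⇒⊆ (y∷τ⊆x∷σ ∘ there) (All¬⇒¬Any y∉τ))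
  ... | k , k≤ , σ→τ = k , k≤ , Steps-∷ x σ→τ

  swapChangesPrefix : ∀ {l m} (σ : Vec A l) → 0 < m → m < l → Unique (toList σ) →
                      ∃ λ σ′ → AdjSwap σ σ′ × take m (toList σ′) ≢ take m (toList σ)
  swapChangesPrefix {m = 1} (x ∷ y ∷ σ) _ _ ((x≢y ∷ _) ∷ _) =
    y ∷ x ∷ σ , here x y σ , x≢y ∘ sym ∘ proj₁ ∘ ∷-injective
  swapChangesPrefix {m = 1} (x ∷ []) _ (s≤s ()) _
  swapChangesPrefix {m = suc (suc m)} (x ∷ σ) _ (s≤s m<l) (_ ∷ !σ)
    with swapChangesPrefix σ (s≤s z≤n) m<l !σ
  ... | σ′ , s , prefix≢ = x ∷ σ′ , there x s , prefix≢ ∘ ∷-injectiveʳ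

IsPerm⇒∈ : ∀ {n} {σ : Word n} → IsPerm σ → ∀ y → y ∈ toList σ
IsPerm⇒∈ {n} {σ} !σ y = Unique-⊆-length≥⇒⊇ _≟_ !σ (λ {z} _ → ∈-allFin z) |allFin|≤|σ| (∈-allFin y)
  where
  |allFin|≤|σ| : length (allFin n) ≤ length (toList σ)
  |allFin|≤|σ| = ≤-reflexive (trans (length-tabulate id) (sym (length-toList σ)))

prefix : ∀ {n} → ℕ → Word n → List (Fin n)
prefix m σ = take m (toList σ)

prefix∈injectiveWords : ∀ {n m} {σ : Word n} → m ≤ n → IsPerm σ →
                        prefix m σ ∈ injectiveWords (allFin n) m
prefix∈injectiveWords {n} {m} {σ} m≤n !σ =
  subst (λ k → prefix m σ ∈ injectiveWords (allFin n) k) |prefix|≡m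
        (∈-injectiveWords (take⁺ m !σ) (λ {z} _ → ∈-allFin z))
  where
  |prefix|≡m : length (prefix m σ) ≡ m
  |prefix|≡m = begin
    length (take m (toList σ))  ≡⟨ length-take m (toList σ) ⟩
    m ⊓ length (toList σ)       ≡⟨ cong (m ⊓_) (length-toList σ) ⟩
    m ⊓ n                       ≡⟨ m≤n⇒m⊓n≡m m≤n ⟩
    m                           ∎
    where open ≡-Reasoning

samePrefix⇒within : ∀ {n t} {σ τ : Word n} → t ≤ n → IsPerm σ → IsPerm τ →
                    prefix (n ∸ t) σ ≡ prefix (n ∸ t) τ → StepsWithin (t C 2) σ τ
samePrefix⇒within {n} {t} {σ} {τ} t≤n !σ !τ samePrefix =
  subst (λ s → StepsWithin (s C 2) σ τ) (m∸[m∸n]≡n t≤n)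
        (samePrefixWithin (n ∸ t) σ τ samePrefix !τ (λ {z} _ → IsPerm⇒∈ !σ z))

n!/t!≡nP′[n∸t] : ∀ {n t} → t ≤ n → (n ! / t !) {{t !≢0}} ≡ n P′ (n ∸ t)
n!/t!≡nP′[n∸t] {n} {t} t≤n =
  sym (trans (nP′k≡n!/[n∸k]! (m∸n≤m n t)) (/-congʳ (cong _! (m∸[m∸n]≡n t≤n))))
  where
  instance
    _ = (n ∸ (n ∸ t)) !≢0
    _ = t !≢0

module TBalancedCode {n t : ℕ} (t≤n : t ≤ n) {𝒞 : List (Word n)} (perms : All IsPerm 𝒞)
                     (unique : Unique 𝒞) (far : MinDistGT 𝒞 (t C 2))
                     (|𝒞|≡nP′[n∸t] : length 𝒞 ≡ n P′ (n ∸ t)) where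

  permAt : ∀ {σ} → σ ∈ 𝒞 → IsPerm σ
  permAt = All.lookup perms

  codePrefixes : List (List (Fin n))
  codePrefixes = map (prefix (n ∸ t)) 𝒞

  codePrefixes-unique : Unique codePrefixes
  codePrefixes-unique = Unique-map⁺-on (prefix (n ∸ t)) distinctPrefixes unique
    where
    distinctPrefixes : ∀ {σ τ} → σ ∈ 𝒞 → τ ∈ 𝒞 → σ ≢ τ → prefix (n ∸ t) σ ≢ prefix (n ∸ t) τ
    distinctPrefixes σ∈𝒞 τ∈𝒞 σ≢τ samePrefix with
      samePrefix⇒within t≤n (permAt σ∈𝒞) (permAt τ∈𝒞) samePrefix
    ... | k , k≤tC2 , σ→τ = <⇒≱ (far σ∈𝒞 τ∈𝒞 σ≢τ k σ→τ) k≤tC2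

  codePrefixes-complete : ∀ {σ} → IsPerm σ → prefix (n ∸ t) σ ∈ codePrefixes
  codePrefixes-complete !σ =
    Unique-⊆-length≥⇒⊇ (≡-dec _≟_) codePrefixes-unique codePrefixes⊆injectiveWords
                       |injectiveWords|≤|codePrefixes| (prefix∈injectiveWords (m∸n≤m n t) !σ)
    where
    codePrefixes⊆injectiveWords : codePrefixes ⊆ injectiveWords (allFin n) (n ∸ t)
    codePrefixes⊆injectiveWords w∈ with ∈-map⁻ (prefix (n ∸ t)) w∈
    ... | σ , σ∈𝒞 , refl = prefix∈injectiveWords (m∸n≤m n t) (permAt σ∈𝒞)

    |injectiveWords|≤|codePrefixes| :
      length (injectiveWords (allFin n) (n ∸ t)) ≤ length codePrefixes
    |injectiveWords|≤|codePrefixes| = ≤-reflexive (begin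
      length (injectiveWords (allFin n) (n ∸ t)) ≡⟨ length-injectiveWords (allFin n) (n ∸ t) ⟩
      length (allFin n) P′ (n ∸ t)               ≡⟨ cong (_P′ (n ∸ t)) (length-tabulate id) ⟩
      n P′ (n ∸ t)                               ≡⟨ |𝒞|≡nP′[n∸t] ⟨
      length 𝒞                                   ≡⟨ length-map (prefix (n ∸ t)) 𝒞 ⟨
      length codePrefixes                        ∎)
      where open ≡-Reasoning

  neighbour : 1 ≤ t → t < n → ∀ {σ} → σ ∈ 𝒞 →
              ∃ λ τ → τ ∈ 𝒞 × σ ≢ τ × StepsWithin (suc (t C 2)) σ τ
  neighbour 1≤t t<n {σ} σ∈𝒞
    with swapChangesPrefix σ (m<n⇒0<n∸m t<n) (∸-monoʳ-< 1≤t t≤n) (permAt σ∈𝒞)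
  ... | σ′ , s , prefix≢
    with ∈-map⁻ (prefix (n ∸ t)) (codePrefixes-complete (AdjSwap-Unique s (permAt σ∈𝒞)))
  ... | τ , τ∈𝒞 , samePrefix
    with samePrefix⇒within t≤n (AdjSwap-Unique s (permAt σ∈𝒞)) (permAt τ∈𝒞) samePrefix
  ... | k , k≤tC2 , σ′→τ =
    τ , τ∈𝒞 , (λ { refl → prefix≢ samePrefix }) , suc k , s≤s k≤tC2 , step s σ′→τ

  lowerBound : ∀ {σ τ} → σ ∈ 𝒞 → τ ∈ 𝒞 → σ ≢ τ → ∀ k → Steps k σ τ → t C 2 + 1 ≤ k
  lowerBound σ∈𝒞 τ∈𝒞 σ≢τ k σ→τ = subst (_≤ k) (+-comm 1 (t C 2)) (far σ∈𝒞 τ∈𝒞 σ≢τ k σ→τ)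

  minDist : 1 ≤ t → t < n → ∀ {σ} → σ ∈ 𝒞 → MinDist 𝒞 (t C 2 + 1)
  minDist 1≤t t<n {σ} σ∈𝒞 with neighbour 1≤t t<n σ∈𝒞
  ... | τ , τ∈𝒞 , σ≢τ , k , k≤1+tC2 , σ→τ =
    (σ , τ , σ∈𝒞 , τ∈𝒞 , σ≢τ , subst (λ d → Steps d σ τ) k≡tC2+1 σ→τ , lowerBound σ∈𝒞 τ∈𝒞 σ≢τ)
    , lowerBound
    where
    k≡tC2+1 : k ≡ t C 2 + 1
    k≡tC2+1 = ≤-antisym (subst (k ≤_) (+-comm 1 (t C 2)) k≤1+tC2) (lowerBound σ∈𝒞 τ∈𝒞 σ≢τ k σ→τ)

corollary3p10 : (n t : ℕ) → 1 ≤ t → t ≤ n → (𝒞 : List (Word n)) →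
    IsCode 𝒞 → TBalanced n t 𝒞 → MinDist 𝒞 (t C 2 + 1)
corollary3p10 n t _ t≤n [] (_ , _ , ()) _
corollary3p10 n t 1≤t t≤n (_ ∷ _) (perms , unique , 2≤|𝒞|) (far , |𝒞|≡n!/t!)
  with m≤n⇒m<n∨m≡n t≤n
... | inj₂ refl = contradiction (trans |𝒞|≡n!/t! (n/n≡1 (n !) {{n !≢0}})) (≢-sym (<⇒≢ 2≤|𝒞|))
... | inj₁ t<n = minDist 1≤t t<n (here refl)
  where open TBalancedCode t≤n perms unique far (trans |𝒞|≡n!/t! (n!/t!≡nP′[n∸t] t≤n))
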